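{- Let $\sigma\in S_n$ be written as a product $\sigma=\tau_1\cdots\tau_j$ of $j\ge1$ pairwise disjoint cycles, each of length at least $2$, and let $x,y$ be two new points, with $S_{n+2}$ the symmetric group on $\{1,\dots,n,x,y\}$. For a cycle $\tau=(a_1\;\cdots\;a_k)$ ($k\ge2$) define $$\check{\tau}=(x\;a_2)(x\;a_3)\cdots(x\;a_k)\,(y\;a_1)(y\;a_2)(x\;a_1).$$ Then $\sigma^{ -1}$ can be written as a product of distinct transpositions each moving $x$ or $y$; specifically, $$\sigma^{ -1}=\begin{cases}(x\;y)\,\check{\tau}_j\cdots\check{\tau}_1 & \text{if } j \text{ is odd},\\ \check{\tau}_j\cdots\check{\tau}_1 & \text{if } j \text{ is even}.\end{cases}$$
   Context: Products of permutations are compositions, the rightmost factor applied first. $S_n$ is viewed inside $S_{n+2}$ as the permutations fixing $x$ and $y$. -}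

module Defs where

open import Data.Nat using (ℕ; zero; suc; _≤_)
open import Data.Fin using (Fin)
open import Data.Fin.Properties using () renaming (_≟_ to _≟ᶠ_)
open import Data.List using (List; []; _∷_; _++_; map; reverse; concatMap; length)
open import Data.List.Membership.Propositional using (_∈_)
open import Data.List.Relation.Unary.All using (All)
open import Data.List.Relation.Unary.AllPairs using (AllPairs)
open import Data.List.Relation.Unary.Unique.Propositional using (Unique)
open import Data.Product using (_×_; _,_)
open import Data.Sum using (_⊎_)
open import Relation.Nullary using (¬_; yes; no; Dec)
open import Relation.Binary.PropositionalEquality using (_≡_; refl)
open import Function using (_∘_; id)

data Pt (n : ℕ) : Set where
  old : Fin n → Pt n
  x   : Pt n
  y   : Pt n

_≟ₚ_ : ∀ {n} (p q : Pt n) → Dec (p ≡ q)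
old i ≟ₚ old j with i ≟ᶠ j
... | yes refl = yes refl
... | no ne = no λ { refl → ne refl }
old _ ≟ₚ x = no λ ()
old _ ≟ₚ y = no λ ()
x ≟ₚ old _ = no λ ()
x ≟ₚ x = yes refl
x ≟ₚ y = no λ ()
y ≟ₚ old _ = no λ ()
y ≟ₚ x = no λ ()
y ≟ₚ y = yes refl

-- Permutations are represented by their underlying functions;
-- products are compositions (rightmost factor applied first).

-- The cycle (a₁ a₂ ⋯ a_k) : a₁ ↦ a₂ ↦ ⋯ ↦ a_k ↦ a₁, other points fixed.
private
  -- cycStep first b rest z : image of z under the tail b ∷ rest of the cycle
  cycStep : ∀ {n} → Fin n → Fin n → List (Fin n) → Fin n → Fin n
  cycStep first b [] z with z ≟ᶠ b
  ... | yes _ = first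
  ... | no _ = z
  cycStep first b (c ∷ rest) z with z ≟ᶠ b
  ... | yes _ = c
  ... | no _ = cycStep first c rest z

cycle : ∀ {n} → List (Fin n) → Fin n → Fin n
cycle [] z = z
cycle (a ∷ as) z = cycStep a a as z

cycleProduct : ∀ {n} → List (List (Fin n)) → Fin n → Fin n
cycleProduct [] = id
cycleProduct (c ∷ cs) = cycle c ∘ cycleProduct cs

extend : ∀ {n} → (Fin n → Fin n) → Pt n → Pt n
extend f (old i) = old (f i)
extend f x = x
extend f y = y

Transp : ℕ → Set
Transp n = Pt n × Pt n

swap : ∀ {n} → Transp n → Pt n → Pt n
swap (p , q) z with z ≟ₚ p
... | yes _ = q
... | no _ with z ≟ₚ q
...   | yes _ = p
...   | no _ = z

wordProduct : ∀ {n} → List (Transp n) → Pt n → Pt n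
wordProduct [] = id
wordProduct (t ∷ ts) = swap t ∘ wordProduct ts

SameTransp : ∀ {n} → Transp n → Transp n → Set
SameTransp (a , b) (c , d) = (a ≡ c × b ≡ d) ⊎ (a ≡ d × b ≡ c)

MovesXorY : ∀ {n} → Transp n → Set
MovesXorY (p , q) = ¬ (p ≡ q) × ((p ≡ x ⊎ p ≡ y) ⊎ (q ≡ x ⊎ q ≡ y))

-- τ̌ for τ = (a₁ ⋯ a_k), k ≥ 2, as the word
-- (x a₂)(x a₃)⋯(x a_k)(y a₁)(y a₂)(x a₁).
-- (For lists of length < 2 the value is irrelevant.)
check : ∀ {n} → List (Fin n) → List (Transp n)
check [] = []
check (a₁ ∷ []) = []
check (a₁ ∷ a₂ ∷ rest) =
  map (λ a → (x , old a)) (a₂ ∷ rest) ++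
  ((y , old a₁) ∷ (y , old a₂) ∷ (x , old a₁) ∷ [])

checkWord : ∀ {n} → List (List (Fin n)) → List (Transp n)
checkWord cs = concatMap check (reverse cs)

Disjoint : ∀ {n} → List (Fin n) → List (Fin n) → Set
Disjoint c d = ∀ a → a ∈ c → ¬ (a ∈ d)

ValidCycles : ∀ {n} → List (List (Fin n)) → Set
ValidCycles cs =
  1 ≤ length cs ×
  All (λ c → 2 ≤ length c × Unique c) cs ×
  AllPairs Disjoint cs

IsDistinctXYWordForInverse : ∀ {n} → (Fin n → Fin n) → List (Transp n) → Set
IsDistinctXYWordForInverse σ w =
  (∀ p → wordProduct w (extend σ p) ≡ p) ×
  (∀ p → extend σ (wordProduct w p) ≡ p) ×
  All MovesXorY w ×
  AllPairs (λ s t → ¬ SameTransp s t) w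

-- For a cycle τ = (a₁ ⋯ a_k) one checks pointwise that τ̌ τ = (x y); the heart
-- of it is that the chain (x a₂)⋯(x a_k)(x a₁) equals (x a₁) τ⁻¹.  Since (x y)
-- commutes with every permutation fixing x and y, disjoint cycles give
-- τ̌_j ⋯ τ̌_1 σ = (x y)^j, so τ̌_j ⋯ τ̌_1 equals σ⁻¹ up to the factor (x y)^j.
-- Every factor of τ̌ joins x or y to a point of τ, and within τ̌ these pairs are
-- distinct because the aᵢ are; disjointness of the cycles does the rest.
module Submission where

open import Defs
open import Data.Nat using (ℕ; zero; suc; _%_; _≤_; s≤s)
open import Data.Fin using (Fin)
open import Data.Fin.Properties using () renaming (_≟_ to _≟ᶠ_)
open import Data.List using (List; []; _∷_; [_]; _++_; map; reverse; concatMap; length)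
open import Data.List.Properties using (unfold-reverse; concatMap-++; ++-identityʳ)
open import Data.List.Relation.Unary.All as All using (All; []; _∷_)
import Data.List.Relation.Unary.All.Properties as All
open import Data.List.Relation.Unary.AllPairs as AllPairs using (AllPairs; []; _∷_)
import Data.List.Relation.Unary.AllPairs.Properties as AllPairs
open import Data.List.Relation.Unary.Unique.Propositional using (Unique)
open import Data.Product using (Σ; _×_; _,_)
open import Data.Sum using (_⊎_; inj₁; inj₂)
open import Data.Empty using (⊥-elim)
open import Function using (_∘_; id)
open import Relation.Nullary using (¬_; Dec; yes; no)
open import Relation.Unary using (U)
open import Relation.Binary.PropositionalEquality
  using (_≡_; _≢_; _≗_; refl; sym; trans; cong; subst; module ≡-Reasoning)

private
  variable
    n : ℕ
    a b c z : Fin n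
    rest : List (Fin n)

old-injective : old a ≡ old b → a ≡ b
old-injective refl = refl

swap-sendsˡ : (p q : Pt n) → swap (p , q) p ≡ q
swap-sendsˡ p q with p ≟ₚ p
... | yes _ = refl
... | no p≢p = ⊥-elim (p≢p refl)

swap-sendsʳ : (p q : Pt n) → swap (p , q) q ≡ p
swap-sendsʳ p q with q ≟ₚ p
... | yes q≡p = q≡p
... | no _ with q ≟ₚ q
...   | yes _ = refl
...   | no q≢q = ⊥-elim (q≢q refl)

swap-fixes : (p q : Pt n) {r : Pt n} → r ≢ p → r ≢ q → swap (p , q) r ≡ r
swap-fixes p q {r} r≢p r≢q with r ≟ₚ p
... | yes r≡p = ⊥-elim (r≢p r≡p)
... | no _ with r ≟ₚ q
...   | yes r≡q = ⊥-elim (r≢q r≡q)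
...   | no _ = refl

swap-involutive : (t : Transp n) → swap t ∘ swap t ≗ id
swap-involutive (p , q) r with r ≟ₚ p
... | yes refl = swap-sendsʳ r q
... | no r≢p with r ≟ₚ q
...   | yes refl = swap-sendsˡ p r
...   | no r≢q = swap-fixes p q r≢p r≢q

wordProduct-++ : (u v : List (Transp n)) → wordProduct (u ++ v) ≗ wordProduct u ∘ wordProduct v
wordProduct-++ []      v p = refl
wordProduct-++ (t ∷ u) v p = cong (swap t) (wordProduct-++ u v p)

wordProduct-reverse-inverseˡ : (w : List (Transp n)) → wordProduct (reverse w) ∘ wordProduct w ≗ id
wordProduct-reverse-inverseˡ []      p = refl
wordProduct-reverse-inverseˡ (t ∷ w) p = begin
  wordProduct (reverse (t ∷ w)) (swap t (wordProduct w p))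
    ≡⟨ cong (λ v → wordProduct v (swap t (wordProduct w p))) (unfold-reverse t w) ⟩
  wordProduct (reverse w ++ [ t ]) (swap t (wordProduct w p))
    ≡⟨ wordProduct-++ (reverse w) [ t ] _ ⟩
  wordProduct (reverse w) (swap t (swap t (wordProduct w p)))
    ≡⟨ cong (wordProduct (reverse w)) (swap-involutive t _) ⟩
  wordProduct (reverse w) (wordProduct w p)
    ≡⟨ wordProduct-reverse-inverseˡ w p ⟩
  p ∎
  where open ≡-Reasoning

-- A word product has a left inverse, so any right inverse is also a left inverse.
wordProduct-inverseʳ⇒inverseˡ : (w : List (Transp n)) {f : Pt n → Pt n} →
  wordProduct w ∘ f ≗ id → f ∘ wordProduct w ≗ id
wordProduct-inverseʳ⇒inverseˡ w {f} wf≗id p = begin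
  f (W p)          ≡⟨ sym (wordProduct-reverse-inverseˡ w (f (W p))) ⟩
  W⁻¹ (W (f (W p))) ≡⟨ cong W⁻¹ (wf≗id (W p)) ⟩
  W⁻¹ (W p)        ≡⟨ wordProduct-reverse-inverseˡ w p ⟩
  p                ∎
  where
  open ≡-Reasoning
  W = wordProduct w
  W⁻¹ = wordProduct (reverse w)

extend-id : extend {n} id ≗ id
extend-id (old i) = refl
extend-id x       = refl
extend-id y       = refl

extend-∘ : (f g : Fin n → Fin n) → extend (f ∘ g) ≗ extend f ∘ extend g
extend-∘ f g (old i) = refl
extend-∘ f g x       = refl
extend-∘ f g y       = refl

swapXY-extend : (f : Fin n → Fin n) → swap (x , y) ∘ extend f ≗ extend f ∘ swap (x , y)
swapXY-extend f (old i) = refl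
swapXY-extend f x       = refl
swapXY-extend f y       = refl

swapXY^ : ℕ → Pt n → Pt n
swapXY^ zero    = id
swapXY^ (suc m) = swapXY^ m ∘ swap (x , y)

swapXY^-even : (m : ℕ) → m % 2 ≡ 0 → swapXY^ {n} m ≗ id
swapXY^-even zero          _    p = refl
swapXY^-even (suc (suc m)) even p =
  trans (swapXY^-even m even _) (swap-involutive (x , y) p)

swapXY^-odd : (m : ℕ) → m % 2 ≡ 1 → swapXY^ {n} m ≗ swap (x , y)
swapXY^-odd (suc zero)    _   p = refl
swapXY^-odd (suc (suc m)) odd p =
  trans (swapXY^-odd m odd _) (cong (swap (x , y)) (swap-involutive (x , y) p))

cycle-head : (a b : Fin n) (rest : List (Fin n)) → cycle (a ∷ b ∷ rest) a ≡ b
cycle-head a b rest with a ≟ᶠ a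
... | yes _ = refl
... | no a≢a = ⊥-elim (a≢a refl)

cycle-closes : a ≢ b → cycle (a ∷ b ∷ []) b ≡ a
cycle-closes {a = a} {b} a≢b with b ≟ᶠ a
... | yes b≡a = ⊥-elim (a≢b (sym b≡a))
... | no _ with b ≟ᶠ b
...   | yes _ = refl
...   | no b≢b = ⊥-elim (b≢b refl)

cycle-second : a ≢ b → cycle (a ∷ b ∷ c ∷ rest) b ≡ c
cycle-second {a = a} {b} a≢b with b ≟ᶠ a
... | yes b≡a = ⊥-elim (a≢b (sym b≡a))
... | no _ with b ≟ᶠ b
...   | yes _ = refl
...   | no b≢b = ⊥-elim (b≢b refl)

cycle-fixes : z ≢ a → z ≢ b → cycle (a ∷ b ∷ []) z ≡ z
cycle-fixes {z = z} {a} {b} z≢a z≢b with z ≟ᶠ a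
... | yes z≡a = ⊥-elim (z≢a z≡a)
... | no _ with z ≟ᶠ b
...   | yes z≡b = ⊥-elim (z≢b z≡b)
...   | no _ = refl

cycle-skip : z ≢ a → z ≢ b → cycle (a ∷ b ∷ c ∷ rest) z ≡ cycle (a ∷ c ∷ rest) z
cycle-skip {z = z} {a} {b} z≢a z≢b with z ≟ᶠ a
... | yes z≡a = ⊥-elim (z≢a z≡a)
... | no _ with z ≟ᶠ b
...   | yes z≡b = ⊥-elim (z≢b z≡b)
...   | no _ = refl

xChain : List (Fin n) → Pt n → Pt n
xChain as = wordProduct (map (λ a → (x , old a)) as)

xChain-y : (as : List (Fin n)) → xChain as y ≡ y
xChain-y []       = refl
xChain-y (a ∷ as) = trans (cong (swap (x , old a)) (xChain-y as)) (swap-fixes x (old a) (λ ()) (λ ()))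

xChain-fixes : (as : List (Fin n)) → All (z ≢_) as → xChain as (old z) ≡ old z
xChain-fixes []       []            = refl
xChain-fixes (a ∷ as) (z≢a ∷ z∉as) =
  trans (cong (swap (x , old a)) (xChain-fixes as z∉as))
        (swap-fixes x (old a) (λ ()) (z≢a ∘ old-injective))

xChain-head : All (b ≢_) rest → xChain (b ∷ rest) (old b) ≡ x
xChain-head {b = b} {rest} b∉rest =
  trans (cong (swap (x , old b)) (xChain-fixes rest b∉rest)) (swap-sendsʳ x (old b))

xChain-undoes-cycle : All (a ≢_) (b ∷ rest) → Unique (b ∷ rest) → z ≢ a →
  xChain (b ∷ rest) (swap (x , old a) (old (cycle (a ∷ b ∷ rest) z))) ≡ old z
xChain-undoes-cycle {a = a} {b} {[]} {z} (a≢b ∷ []) _ z≢a with z ≟ᶠ b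
... | yes refl = begin
  xChain [ z ] (swap (x , old a) (old (cycle (a ∷ z ∷ []) z)))
    ≡⟨ cong (xChain [ z ] ∘ swap (x , old a) ∘ old) (cycle-closes a≢b) ⟩
  xChain [ z ] (swap (x , old a) (old a)) ≡⟨ cong (xChain [ z ]) (swap-sendsʳ x (old a)) ⟩
  swap (x , old z) x                      ≡⟨ swap-sendsˡ x (old z) ⟩
  old z                                   ∎
  where open ≡-Reasoning
... | no z≢b = begin
  xChain [ b ] (swap (x , old a) (old (cycle (a ∷ b ∷ []) z)))
    ≡⟨ cong (xChain [ b ] ∘ swap (x , old a) ∘ old) (cycle-fixes z≢a z≢b) ⟩
  xChain [ b ] (swap (x , old a) (old z))
    ≡⟨ cong (xChain [ b ]) (swap-fixes x (old a) (λ ()) (z≢a ∘ old-injective)) ⟩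
  swap (x , old b) (old z) ≡⟨ swap-fixes x (old b) (λ ()) (z≢b ∘ old-injective) ⟩
  old z                    ∎
  where open ≡-Reasoning
xChain-undoes-cycle {a = a} {b} {c ∷ rest} {z} (a≢b ∷ a∉c∷rest) ((b≢c ∷ _) ∷ c∷rest!) z≢a
  with z ≟ᶠ b
... | yes refl = begin
  xChain (z ∷ c ∷ rest) (swap (x , old a) (old (cycle (a ∷ z ∷ c ∷ rest) z)))
    ≡⟨ cong (xChain (z ∷ c ∷ rest) ∘ swap (x , old a) ∘ old) (cycle-second a≢b) ⟩
  xChain (z ∷ c ∷ rest) (swap (x , old a) (old c))
    ≡⟨ cong (xChain (z ∷ c ∷ rest)) (swap-fixes x (old a) (λ ()) (All.head a∉c∷rest ∘ sym ∘ old-injective)) ⟩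
  swap (x , old z) (xChain (c ∷ rest) (old c))
    ≡⟨ cong (swap (x , old z)) (xChain-head (AllPairs.head c∷rest!)) ⟩
  swap (x , old z) x ≡⟨ swap-sendsˡ x (old z) ⟩
  old z              ∎
  where open ≡-Reasoning
... | no z≢b = begin
  xChain (b ∷ c ∷ rest) (swap (x , old a) (old (cycle (a ∷ b ∷ c ∷ rest) z)))
    ≡⟨ cong (xChain (b ∷ c ∷ rest) ∘ swap (x , old a) ∘ old) (cycle-skip z≢a z≢b) ⟩
  swap (x , old b) (xChain (c ∷ rest) (swap (x , old a) (old (cycle (a ∷ c ∷ rest) z))))
    ≡⟨ cong (swap (x , old b)) (xChain-undoes-cycle a∉c∷rest c∷rest! z≢a) ⟩
  swap (x , old b) (old z) ≡⟨ swap-fixes x (old b) (λ ()) (z≢b ∘ old-injective) ⟩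
  old z                    ∎
  where open ≡-Reasoning

check-cycle : Unique (a ∷ b ∷ rest) →
  wordProduct (check (a ∷ b ∷ rest)) ∘ extend (cycle (a ∷ b ∷ rest)) ≗ swap (x , y)
check-cycle {a = a} {b} {rest} ((a≢b ∷ a∉rest) ∷ b∷rest!) p =
  trans (wordProduct-++ (map (λ a → (x , old a)) (b ∷ rest))
                        ((y , old a) ∷ (y , old b) ∷ (x , old a) ∷ []) _)
        (pointwise p)
  where
  open ≡-Reasoning
  chain = xChain (b ∷ rest)
  τ = cycle (a ∷ b ∷ rest)
  turn = swap (y , old a) ∘ swap (y , old b)

  pointwise-old : ∀ z → Dec (z ≡ a) → chain (turn (swap (x , old a) (old (τ z)))) ≡ old z
  pointwise-old z (yes refl) = begin
    chain (turn (swap (x , old z) (old (τ z))))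
      ≡⟨ cong (chain ∘ turn ∘ swap (x , old z) ∘ old) (cycle-head z b rest) ⟩
    chain (turn (swap (x , old z) (old b)))
      ≡⟨ cong (chain ∘ turn) (swap-fixes x (old z) (λ ()) (a≢b ∘ sym ∘ old-injective)) ⟩
    chain (swap (y , old z) (swap (y , old b) (old b)))
      ≡⟨ cong (chain ∘ swap (y , old z)) (swap-sendsʳ y (old b)) ⟩
    chain (swap (y , old z) y) ≡⟨ cong chain (swap-sendsˡ y (old z)) ⟩
    chain (old z)              ≡⟨ xChain-fixes (b ∷ rest) (a≢b ∷ a∉rest) ⟩
    old z                      ∎
  pointwise-old z (no z≢a) = trans (cong chain turn-fixes-q) chain-q
    where
    q = swap (x , old a) (old (τ z))
    chain-q : chain q ≡ old z
    chain-q = xChain-undoes-cycle (a≢b ∷ a∉rest) b∷rest! z≢a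
    -- q is none of y, old a, old b, because chain sends those elsewhere than old z.
    avoids : ∀ {r} → chain r ≢ old z → q ≢ r
    avoids chain-r≢z q≡r = chain-r≢z (trans (cong chain (sym q≡r)) chain-q)
    q≢y : q ≢ y
    q≢y = avoids λ e → y≢old (trans (sym (xChain-y (b ∷ rest))) e)
      where y≢old : y ≢ old z
            y≢old ()
    q≢a : q ≢ old a
    q≢a = avoids λ e → z≢a (sym (old-injective (trans (sym (xChain-fixes (b ∷ rest) (a≢b ∷ a∉rest))) e)))
    q≢b : q ≢ old b
    q≢b = avoids λ e → x≢old (trans (sym (xChain-head (AllPairs.head b∷rest!))) e)
      where x≢old : x ≢ old z
            x≢old ()
    turn-fixes-q : turn q ≡ q
    turn-fixes-q = trans (cong (swap (y , old a)) (swap-fixes y (old b) q≢y q≢b))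
                         (swap-fixes y (old a) q≢y q≢a)

  pointwise : ∀ p → chain (turn (swap (x , old a) (extend τ p))) ≡ swap (x , y) p
  pointwise x = begin
    chain (turn (swap (x , old a) x))
      ≡⟨ cong (chain ∘ turn) (swap-sendsˡ x (old a)) ⟩
    chain (swap (y , old a) (swap (y , old b) (old a)))
      ≡⟨ cong (chain ∘ swap (y , old a)) (swap-fixes y (old b) (λ ()) (a≢b ∘ old-injective)) ⟩
    chain (swap (y , old a) (old a)) ≡⟨ cong chain (swap-sendsʳ y (old a)) ⟩
    chain y                          ≡⟨ xChain-y (b ∷ rest) ⟩
    y                                ∎
  pointwise y = begin
    chain (turn (swap (x , old a) y))
      ≡⟨ cong (chain ∘ turn) (swap-fixes x (old a) {y} (λ ()) (λ ())) ⟩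
    chain (swap (y , old a) (swap (y , old b) y))
      ≡⟨ cong (chain ∘ swap (y , old a)) (swap-sendsˡ y (old b)) ⟩
    chain (swap (y , old a) (old b))
      ≡⟨ cong chain (swap-fixes y (old a) (λ ()) (a≢b ∘ sym ∘ old-injective)) ⟩
    chain (old b) ≡⟨ xChain-head (AllPairs.head b∷rest!) ⟩
    x             ∎
  pointwise (old z) = pointwise-old z (z ≟ᶠ a)

ValidCycle : List (Fin n) → Set
ValidCycle c = 2 ≤ length c × Unique c

checkWord-∷ : (c : List (Fin n)) (cs : List (List (Fin n))) →
  checkWord (c ∷ cs) ≡ checkWord cs ++ check c
checkWord-∷ c cs = begin
  concatMap check (reverse (c ∷ cs))   ≡⟨ cong (concatMap check) (unfold-reverse c cs) ⟩
  concatMap check (reverse cs ++ [ c ]) ≡⟨ concatMap-++ check (reverse cs) [ c ] ⟩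
  checkWord cs ++ (check c ++ [])       ≡⟨ cong (checkWord cs ++_) (++-identityʳ (check c)) ⟩
  checkWord cs ++ check c               ∎
  where open ≡-Reasoning

checkWord-cycleProduct : (cs : List (List (Fin n))) → All ValidCycle cs →
  wordProduct (checkWord cs) ∘ extend (cycleProduct cs) ≗ swapXY^ (length cs)
checkWord-cycleProduct []                 []                  = extend-id
checkWord-cycleProduct ([] ∷ cs)          ((() , _) ∷ _)
checkWord-cycleProduct ((a ∷ []) ∷ cs)    ((s≤s () , _) ∷ _)
checkWord-cycleProduct (c@(a ∷ b ∷ rest) ∷ cs) ((_ , c!) ∷ valid) p = begin
  wordProduct (checkWord (c ∷ cs)) (extend (cycle c ∘ σ) p)
    ≡⟨ cong (λ w → wordProduct w (extend (cycle c ∘ σ) p)) (checkWord-∷ c cs) ⟩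
  wordProduct (checkWord cs ++ check c) (extend (cycle c ∘ σ) p)
    ≡⟨ wordProduct-++ (checkWord cs) (check c) _ ⟩
  W (wordProduct (check c) (extend (cycle c ∘ σ) p))
    ≡⟨ cong (W ∘ wordProduct (check c)) (extend-∘ (cycle c) σ p) ⟩
  W (wordProduct (check c) (extend (cycle c) (extend σ p)))
    ≡⟨ cong W (check-cycle c! (extend σ p)) ⟩
  W (swap (x , y) (extend σ p))  ≡⟨ cong W (swapXY-extend σ p) ⟩
  W (extend σ (swap (x , y) p))  ≡⟨ checkWord-cycleProduct cs valid (swap (x , y) p) ⟩
  swapXY^ (length cs) (swap (x , y) p) ∎
  where
  open ≡-Reasoning
  σ = cycleProduct cs
  W = wordProduct (checkWord cs)

Distinct : Transp n → Transp n → Set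
Distinct s t = ¬ SameTransp s t

apart : {P Q : Fin n → Set} → (∀ {a} → P a → ¬ Q a) → P a → Q b → a ≢ b
apart P⇒¬Q Pa Qb refl = P⇒¬Q Pa Qb

distinct-edges : {u v : Pt n} → (u ≡ v → a ≢ b) → u ≢ old b → Distinct (u , old a) (v , old b)
distinct-edges a≢b _    (inj₁ (u≡v , a≡b)) = a≢b u≡v (old-injective a≡b)
distinct-edges _   u≢b (inj₂ (u≡b , _))   = u≢b u≡b

XYTransp : (Fin n → Set) → Transp n → Set
XYTransp {n} P t = Σ (Fin n) λ a → P a × (t ≡ (x , old a) ⊎ t ≡ (y , old a))

XYTransp⇒MovesXorY : {P : Fin n → Set} {t : Transp n} → XYTransp P t → MovesXorY t
XYTransp⇒MovesXorY (_ , _ , inj₁ refl) = (λ ()) , inj₁ (inj₁ refl)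
XYTransp⇒MovesXorY (_ , _ , inj₂ refl) = (λ ()) , inj₁ (inj₂ refl)

XYTransp⇒distinct-xy : {P : Fin n → Set} {t : Transp n} → XYTransp P t → Distinct (x , y) t
XYTransp⇒distinct-xy (_ , _ , inj₁ refl) (inj₁ (_ , ()))
XYTransp⇒distinct-xy (_ , _ , inj₁ refl) (inj₂ (() , _))
XYTransp⇒distinct-xy (_ , _ , inj₂ refl) (inj₁ (() , _))
XYTransp⇒distinct-xy (_ , _ , inj₂ refl) (inj₂ (() , _))

XYTransp-distinct : {P Q : Fin n → Set} {s t : Transp n} → (∀ {a} → P a → ¬ Q a) →
  XYTransp P s → XYTransp Q t → Distinct s t
XYTransp-distinct P⇒¬Q (_ , Pa , inj₁ refl) (_ , Qb , inj₁ refl) = distinct-edges (λ _ → apart P⇒¬Q Pa Qb) (λ ())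
XYTransp-distinct P⇒¬Q (_ , Pa , inj₁ refl) (_ , Qb , inj₂ refl) = distinct-edges (λ _ → apart P⇒¬Q Pa Qb) (λ ())
XYTransp-distinct P⇒¬Q (_ , Pa , inj₂ refl) (_ , Qb , inj₁ refl) = distinct-edges (λ _ → apart P⇒¬Q Pa Qb) (λ ())
XYTransp-distinct P⇒¬Q (_ , Pa , inj₂ refl) (_ , Qb , inj₂ refl) = distinct-edges (λ _ → apart P⇒¬Q Pa Qb) (λ ())

check-XYTransp : (c : List (Fin n)) {P : Fin n → Set} → All P c → All (XYTransp P) (check c)
check-XYTransp []             _                = []
check-XYTransp (a ∷ [])       _                = []
check-XYTransp (a ∷ b ∷ rest) (Pa ∷ Pb∷rest) =
  All.++⁺ (All.map⁺ (All.map (λ {c} Pc → c , Pc , inj₁ refl) Pb∷rest))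
          ((a , Pa , inj₂ refl) ∷ (b , All.head Pb∷rest , inj₂ refl) ∷ (a , Pa , inj₁ refl) ∷ [])

checkWord-XYTransp : (cs : List (List (Fin n))) {P : Fin n → Set} →
  All (All P) cs → All (XYTransp P) (checkWord cs)
checkWord-XYTransp []       []          = []
checkWord-XYTransp (c ∷ cs) {P} (Pc ∷ Pcs) = subst (All (XYTransp P)) (sym (checkWord-∷ c cs))
  (All.++⁺ (checkWord-XYTransp cs Pcs) (check-XYTransp c Pc))

check-distinct : Unique (a ∷ b ∷ rest) → AllPairs Distinct (check (a ∷ b ∷ rest))
check-distinct ((a≢b ∷ a∉rest) ∷ b∷rest!) = AllPairs.++⁺
  (AllPairs.map⁺ (AllPairs.map (λ c≢d → distinct-edges (λ _ → c≢d) (λ ())) b∷rest!))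
  ((distinct-edges (λ _ → a≢b) (λ ()) ∷ distinct-edges (λ ()) (λ ()) ∷ []) ∷
   (distinct-edges (λ ()) (λ ()) ∷ []) ∷ [] ∷ [])
  (All.map⁺ (All.map (λ a≢c → distinct-edges (λ ()) (λ ()) ∷ distinct-edges (λ ()) (λ ()) ∷
                              distinct-edges (λ _ → a≢c ∘ sym) (λ ()) ∷ [])
                     (a≢b ∷ a∉rest)))

checkWord-distinct : (cs : List (List (Fin n))) → All ValidCycle cs → AllPairs Disjoint cs →
  AllPairs Distinct (checkWord cs)
checkWord-distinct []                 []                 []           = []
checkWord-distinct ([] ∷ cs)          ((() , _) ∷ _)     _
checkWord-distinct ((a ∷ []) ∷ cs)    ((s≤s () , _) ∷ _) _
checkWord-distinct (c@(a ∷ b ∷ rest) ∷ cs) ((_ , c!) ∷ valid) (c#cs ∷ disjoint) =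
  subst (AllPairs Distinct) (sym (checkWord-∷ c cs))
    (AllPairs.++⁺ (checkWord-distinct cs valid disjoint) (check-distinct c!)
      (All.map (λ s → All.map (XYTransp-distinct id s) (check-XYTransp c (All.tabulate id)))
               (checkWord-XYTransp cs (All.map (λ c#d → All.tabulate (λ a∈d a∈c → c#d _ a∈c a∈d)) c#cs))))

isDistinctXYWordForInverse : (σ : Fin n → Fin n) (w : List (Transp n)) →
  wordProduct w ∘ extend σ ≗ id → All MovesXorY w → AllPairs Distinct w →
  IsDistinctXYWordForInverse σ w
isDistinctXYWordForInverse σ w inverse moves distinct =
  inverse , wordProduct-inverseʳ⇒inverseˡ w inverse , moves , distinct

mainTheorem5 : (n : ℕ) (cs : List (List (Fin n))) → ValidCycles cs →
    (length cs % 2 ≡ 1 →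
      IsDistinctXYWordForInverse (cycleProduct cs) ((x , y) ∷ checkWord cs)) ×
    (length cs % 2 ≡ 0 →
      IsDistinctXYWordForInverse (cycleProduct cs) (checkWord cs))
mainTheorem5 n cs (_ , valid , disjoint) = oddCase , evenCase
  where
  σ = cycleProduct cs
  m = length cs
  W∘σ≗swapXY^ = checkWord-cycleProduct cs valid
  xyTransps : All (XYTransp U) (checkWord cs)
  xyTransps = checkWord-XYTransp cs (All.universal All.universal-U cs)
  moves = All.map XYTransp⇒MovesXorY xyTransps
  distinct = checkWord-distinct cs valid disjoint

  oddCase : m % 2 ≡ 1 → IsDistinctXYWordForInverse σ ((x , y) ∷ checkWord cs)
  oddCase odd = isDistinctXYWordForInverse σ _
    (λ p → trans (cong (swap (x , y)) (trans (W∘σ≗swapXY^ p) (swapXY^-odd m odd p)))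
                 (swap-involutive (x , y) p))
    (((λ ()) , inj₁ (inj₁ refl)) ∷ moves)
    (All.map XYTransp⇒distinct-xy xyTransps ∷ distinct)

  evenCase : m % 2 ≡ 0 → IsDistinctXYWordForInverse σ (checkWord cs)
  evenCase even = isDistinctXYWordForInverse σ _
    (λ p → trans (W∘σ≗swapXY^ p) (swapXY^-even m even p)) moves distinct
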